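{- Let $G$ be a $3$-edge-connected undirected graph (possibly with multiple edges) and $T$ a DFS spanning tree of $G$ rooted at $r$. Let $u,v$ be two vertices such that $u$ is a descendant of $v\neq r$ and $B(u)=B(v)\sqcup\{e\}$ for a back-edge $e=(x,y)$. Then $M(v)\in\{M(u),\tilde{M}(u),M_{low1}(u)\}$. More precisely, either (1) $M(v)=M(u)$ and $e=(\mathit{low_MD}(u),\mathit{low_M}(u))$, or (2) $M(v)=\tilde{M}(u)$ and $e=(M(u),l_1(M(u)))$, or (3) $M(v)=M_{low1}(u)$ and $e=(M_{low2}(u),l_1(M_{low2}(u)))$.
   Context: Vertices are identified with their DFS preorder numbers. A vertex $u$ is an ancestor of $v$ ($v$ a descendant of $u$) if the tree path from $r$ to $v$ contains $u$ (every vertex is an ancestor and descendant of itself). $T(v)$ denotes the set of descendants of $v$. Non-tree edges are back-edges; a back-edge is written $(x,y)$ with $x$ a descendant of $y$. $B(v)$ is the set of back-edges $(x,y)$ with $x$ a descendant of $v$ and $y$ a proper ancestor of $v$; $\sqcup$ denotes disjoint union. $l_1(v)$ is the smallest $y$ such that there is a back-edge $(v,y)$, or $v$ if there is no such back-edge. For $v\neq r$, $\mathit{low1}(v)=\min\{y:\exists (x,y)\in B(v)\}$. The children of a vertex $w$ sorted in non-decreasing order of $\mathit{low1}$ are $c_1(w),c_2(w),\dots$ (ties broken arbitrarily but fixed; $c_i(w)=\emptyset$ if $w$ has fewer than $i$ children). $\mathit{nca}$ denotes nearest common ancestor in $T$. $M(v)=\mathit{nca}\{x:\exists(x,y)\in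 B(v)\}$; $\tilde M(v)=\mathit{nca}\{x:\exists(x,y)\in B(v),\ x \text{ a proper descendant of } M(v)\}$; $M_{low1}(v)=\mathit{nca}\{x:\exists(x,y)\in B(v),\ x\in T(c_1(M(v)))\}$; $M_{low2}(v)=\mathit{nca}\{x:\exists(x,y)\in B(v),\ x\in T(c_2(M(v)))\}$ (each undefined if the set is empty). $\mathit{nextM}(v)$ is the maximum vertex $v'<v$ with $M(v')=M(v)$ ($\emptyset$ if none). For $v$ with $\mathit{nextM}(v)\neq\emptyset$, $\mathit{low_M}(v)=\min\{y:\exists (x,y)\in B(v)\setminus B(\mathit{nextM}(v))\}$ and $\mathit{low_MD}(v)$ is a vertex $x$ such that $(x,\mathit{low_M}(v))$ is a back-edge in $B(v)\setminus B(\mathit{nextM}(v))$. -}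

module Defs where

open import Data.Nat using (ℕ) renaming (suc to 1+)
open import Data.Fin using (Fin; zero; suc; _≤_; _<_)
open import Data.Maybe using (Maybe; just; nothing)
open import Data.Product using (Σ; _×_; _,_)
open import Data.Sum using (_⊎_)
open import Relation.Nullary using (¬_)
open import Relation.Binary.PropositionalEquality using (_≡_; _≢_)

-- A (multi)graph G together with a DFS spanning tree T, vertices
-- identified with their DFS preorder numbers.
--
-- Vertices: Fin (1+ n); the root r is `zero`.  Every non-root vertex
-- `suc k` has a parent `par k`; the tree edge (suc k , par k) is the
-- k-th tree edge.  All other edges of G are back-edges, indexed by
-- Fin m (so parallel edges are distinct), the i-th one being (bx i , by i)
-- with bx i a descendant of by i.

module Tree {n : ℕ} (par : Fin n → Fin (1+ n)) where

  -- Anc u v : u is an ancestor of v (reflexive)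
  data Anc (u : Fin (1+ n)) : Fin (1+ n) → Set where
    anc-refl : Anc u u
    anc-step : (k : Fin n) → Anc u (par k) → Anc u (suc k)

record DFSGraph : Set where
  field
    n   : ℕ
    m   : ℕ
    par : Fin n → Fin (1+ n)
    par< : (k : Fin n) → par k < suc k
  open Tree par public
  field
    -- preorder numbering: each subtree T(u) is an interval starting at u
    preorder : (u v w : Fin (1+ n)) → Anc u v → u ≤ w → w ≤ v → Anc u w
    bx : Fin m → Fin (1+ n)
    by : Fin m → Fin (1+ n)
    -- DFS property: every non-tree edge joins a descendant to an ancestor
    back : (i : Fin m) → Anc (by i) (bx i)

module Notions (G : DFSGraph) where
  open DFSGraph G public

  V : Set
  V = Fin (1+ n)

  r : V
  r = zero

  ProperAnc : V → V → Set
  ProperAnc a b = Anc a b × a ≢ b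

  Edge : Set
  Edge = Fin n ⊎ Fin m

  ends : Edge → V × V
  ends (Data.Sum.inj₁ k) = suc k , par k
  ends (Data.Sum.inj₂ i) = bx i , by i

  data Reach (del : Edge → Set) (a : V) : V → Set where
    reach-refl : Reach del a a
    reach-step : ∀ {b c} → Reach del a b → (e : Edge) → ¬ del e →
                 (ends e ≡ (b , c) ⊎ ends e ≡ (c , b)) → Reach del a c

  ThreeEdgeConnected : Set
  ThreeEdgeConnected =
    (e₁ e₂ : Edge) (a b : V) → Reach (λ e → e ≡ e₁ ⊎ e ≡ e₂) a b

  B : V → Fin m → Set
  B v i = Anc v (bx i) × ProperAnc (by i) v

  Child : V → V → Set
  Child c w = Σ (Fin n) λ k → c ≡ suc k × par k ≡ w

  IsNCA : (V → Set) → V → Set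
  IsNCA S w = Σ V S × (∀ x → S x → Anc w x)
            × (∀ a → (∀ x → S x → Anc a x) → Anc a w)

  IsL1 : V → V → Set
  IsL1 v y = (y ≡ v ⊎ Σ (Fin m) λ i → bx i ≡ v × by i ≡ y)
           × (∀ i → bx i ≡ v → y ≤ by i)

  IsLow1 : V → V → Set
  IsLow1 v y = (Σ (Fin m) λ i → B v i × by i ≡ y) × (∀ i → B v i → y ≤ by i)

  LowLe : V → V → Set
  LowLe a c = ∀ ya yc → IsLow1 a ya → IsLow1 c yc → ya ≤ yc

  -- c₁(w), c₂(w): the first two children of w in a fixed order
  -- sorted by non-decreasing low1 (ties broken arbitrarily)
  record ChildOrder : Set where
    field
      c₁ c₂ : V → Maybe V
      c₁-nothing : ∀ w → c₁ w ≡ nothing → ∀ c → ¬ Child c w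
      c₁-just : ∀ w a → c₁ w ≡ just a →
                Child a w × (∀ c → Child c w → LowLe a c)
      c₂-nothing : ∀ w → c₂ w ≡ nothing → ∀ c → Child c w → c₁ w ≡ just c
      c₂-just : ∀ w b → c₂ w ≡ just b →
                Child b w × c₁ w ≢ just b ×
                (∀ c → Child c w → c₁ w ≢ just c → LowLe b c)

  IsM : V → V → Set
  IsM v = IsNCA (λ x → Σ (Fin m) λ i → B v i × bx i ≡ x)

  IsMtilde : V → V → Set
  IsMtilde v w = Σ V λ mv → IsM v mv ×
    IsNCA (λ x → Σ (Fin m) λ i → B v i × bx i ≡ x × ProperAnc mv x) w

  module _ (co : ChildOrder) where
    open ChildOrder co

    IsMlow1 : V → V → Set
    IsMlow1 v w = Σ V λ mv → IsM v mv × Σ V λ c → c₁ mv ≡ just c ×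
      IsNCA (λ x → Σ (Fin m) λ i → B v i × bx i ≡ x × Anc c x) w

    IsMlow2 : V → V → Set
    IsMlow2 v w = Σ V λ mv → IsM v mv × Σ V λ c → c₂ mv ≡ just c ×
      IsNCA (λ x → Σ (Fin m) λ i → B v i × bx i ≡ x × Anc c x) w

  SameM : V → V → Set
  SameM v w = Σ V λ x → IsM v x × IsM w x

  IsNextM : V → V → Set
  IsNextM v v' = v' < v × SameM v v' × (∀ w → w < v → SameM v w → w ≤ v')

  IsLowM : V → V → Set
  IsLowM v y = Σ V λ v' → IsNextM v v' ×
    (Σ (Fin m) λ i → B v i × ¬ B v' i × by i ≡ y) ×
    (∀ i → B v i → ¬ B v' i → y ≤ by i)

  -- x is an admissible value of low_MD(v)
  IsLowMD : V → V → Set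
  IsLowMD v x = Σ V λ v' → IsNextM v v' × Σ V λ y → IsLowM v y ×
    Σ (Fin m) λ i → B v i × ¬ B v' i × bx i ≡ x × by i ≡ y

-- Since B(v) ⊆ B(u), M(u) is an ancestor of M(v), and u is an ancestor of M(u).
-- If M(v) = M(u), then nextM(u) lies between v and u, so B(v) ⊆ B(nextM(u)) ⊆ B(u);
-- 3-edge-connectivity forbids B(nextM(u)) = B(u), so e is the only edge of
-- B(u) ∖ B(nextM(u)).  Otherwise x ∉ T(M(v)), as M(v) would then be a common
-- ancestor of all the ends of B(u); so e is the only back-edge from T(u) ∖ T(M(v))
-- reaching above u, whence l₁(x) = y.  If x = M(u), the ends of B(u) strictly below
-- M(u) are those of B(v), so M̃(u) = M(v).  If not, M(v) and x lie below distinct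
-- children c and c' of M(u), and low1(c) < y = low1(c') < low1(c'') for every other
-- child c'', so c and c' are the first two children: M_low1(u) = M(v), M_low2(u) = x.

{-# OPTIONS --safe #-}
module Submission where

open import Defs
open import Data.Fin using (Fin; zero; suc; _≤_; _<_; _<?_)
open import Data.Fin.Properties
  using (_≟_; 0≢1+n; any?; all?; suc-injective; ≤-refl; ≤-reflexive; ≤-trans; ≤-total; ≤-antisym; ≤∧≢⇒<; <⇒≢)
open import Data.Fin.Induction using (<-wellFounded)
import Data.Nat as ℕ
import Data.Nat.Properties as ℕₚ
open import Data.Maybe using (just; nothing)
open import Data.Maybe.Properties using (just-injective)
open import Data.Product using (Σ; ∃; _×_; _,_; proj₁; proj₂)
open import Data.Sum using (_⊎_; inj₁; inj₂; [_,_]′)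
open import Data.Empty using (⊥; ⊥-elim)
open import Function using (_∘_; id; flip)
open import Induction.WellFounded using (Acc; acc)
open import Relation.Binary using (Rel; Transitive; Total)
open import Relation.Nullary using (¬_; Dec; yes; no)
open import Relation.Nullary.Decidable using (_×-dec_; _→-dec_; ¬?; map′)
open import Relation.Unary using (Pred; Decidable; _⊆_)
open import Relation.Binary.PropositionalEquality using (_≡_; _≢_; refl; sym; trans; cong; subst)

module _ {a ℓ} {A : Set a} {_≼_ : Rel A ℓ} (≼-trans : Transitive _≼_) (≼-total : Total _≼_) where

  private
    ≼-refl : ∀ {z} → z ≼ z
    ≼-refl {z} = [ id , id ]′ (≼-total z z)

  optimum : ∀ {N p} {P : Pred (Fin N) p} → Decidable P → (f : Fin N → A) → ∃ P →
            ∃ λ i → P i × (∀ j → P j → f i ≼ f j)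
  optimum {ℕ.zero} P? f (() , _)
  optimum {ℕ.suc N} P? f Pi with any? (P? ∘ suc)
  optimum {ℕ.suc N} P? f (zero , P0) | no ¬Ptail =
    zero , P0 , λ { zero _ → ≼-refl ; (suc j) Pj → ⊥-elim (¬Ptail (j , Pj)) }
  optimum {ℕ.suc N} P? f (suc i , Pi) | no ¬Ptail = ⊥-elim (¬Ptail (i , Pi))
  optimum {ℕ.suc N} P? f _ | yes Ptail with optimum (P? ∘ suc) (f ∘ suc) Ptail | P? zero
  ... | i , Pi , opt | no ¬P0 = suc i , Pi , λ { zero P0 → ⊥-elim (¬P0 P0) ; (suc j) Pj → opt j Pj }
  ... | i , Pi , opt | yes P0 with ≼-total (f zero) (f (suc i))
  ...   | inj₁ f0≼ = zero , P0 , λ { zero _ → ≼-refl ; (suc j) Pj → ≼-trans f0≼ (opt j Pj) }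
  ...   | inj₂ ≼f0 = suc i , Pi , λ { zero _ → ≼f0 ; (suc j) Pj → opt j Pj }

module _ {N k p} {P : Pred (Fin N) p} (P? : Decidable P) (f : Fin N → Fin k) where

  minimiser : ∃ P → ∃ λ i → P i × (∀ j → P j → f i ≤ f j)
  minimiser = optimum ≤-trans ≤-total P? f

  maximiser : ∃ P → ∃ λ i → P i × (∀ j → P j → f j ≤ f i)
  maximiser = optimum {_≼_ = flip _≤_} (flip ≤-trans) (flip ≤-total) P? f

module Ancestry (G : DFSGraph) where
  open Notions G

  Anc⇒≤ : ∀ {a b} → Anc a b → a ≤ b
  Anc⇒≤ anc-refl = ≤-refl
  Anc⇒≤ (anc-step k a⊑p) = ℕₚ.≤-trans (Anc⇒≤ a⊑p) (ℕₚ.<⇒≤ (par< k))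

  Anc-trans : ∀ {a b c} → Anc a b → Anc b c → Anc a c
  Anc-trans a⊑b anc-refl = a⊑b
  Anc-trans a⊑b (anc-step k b⊑p) = anc-step k (Anc-trans a⊑b b⊑p)

  Anc-antisym : ∀ {a b} → Anc a b → Anc b a → a ≡ b
  Anc-antisym a⊑b b⊑a = ≤-antisym (Anc⇒≤ a⊑b) (Anc⇒≤ b⊑a)

  Anc-suc-inv : ∀ {a k} → Anc a (suc k) → a ≡ suc k ⊎ Anc a (par k)
  Anc-suc-inv anc-refl = inj₁ refl
  Anc-suc-inv (anc-step k a⊑p) = inj₂ a⊑p

  Anc-of-r : ∀ {a} → Anc a r → a ≡ r
  Anc-of-r anc-refl = refl

  Anc-≢r : ∀ {a b} → Anc a b → a ≢ r → b ≢ r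
  Anc-≢r a⊑b a≢r refl = a≢r (Anc-of-r a⊑b)

  r-Anc : ∀ b → Anc r b
  r-Anc b = go b (<-wellFounded b)
    where
      go : ∀ b → Acc _<_ b → Anc r b
      go zero    _        = anc-refl
      go (suc k) (acc rs) = anc-step k (go (par k) (rs (par< k)))

  Anc? : ∀ a b → Dec (Anc a b)
  Anc? a b = go b (<-wellFounded b)
    where
      go : ∀ b → Acc _<_ b → Dec (Anc a b)
      go zero _ = map′ (λ { refl → anc-refl }) Anc-of-r (a ≟ zero)
      go (suc k) (acc rs) with a ≟ suc k
      ... | yes refl = yes anc-refl
      ... | no a≢k+1 =
        map′ (anc-step k) ([ ⊥-elim ∘ a≢k+1 , id ]′ ∘ Anc-suc-inv) (go (par k) (rs (par< k)))

  ancestors-comparable : ∀ {a b z} → Anc a z → Anc b z → Anc a b ⊎ Anc b a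
  ancestors-comparable anc-refl b⊑a = inj₂ b⊑a
  ancestors-comparable a⊑b anc-refl = inj₁ a⊑b
  ancestors-comparable (anc-step k a⊑p) (anc-step .k b⊑p) = ancestors-comparable a⊑p b⊑p

  ancestors-≤⇒Anc : ∀ {a b z} → Anc a z → Anc b z → a ≤ b → Anc a b
  ancestors-≤⇒Anc a⊑z b⊑z a≤b with ancestors-comparable a⊑z b⊑z
  ... | inj₁ a⊑b = a⊑b
  ... | inj₂ b⊑a = subst (Anc _) (≤-antisym a≤b (Anc⇒≤ b⊑a)) anc-refl

  ProperAnc⇒< : ∀ {a b} → ProperAnc a b → a < b
  ProperAnc⇒< (a⊑b , a≢b) = ≤∧≢⇒< (Anc⇒≤ a⊑b) a≢b

  ProperAnc⇒¬Anc : ∀ {a b} → ProperAnc a b → ¬ Anc b a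
  ProperAnc⇒¬Anc (a⊑b , a≢b) b⊑a = a≢b (Anc-antisym a⊑b b⊑a)

  ProperAnc-Anc-trans : ∀ {a b c} → ProperAnc a b → Anc b c → ProperAnc a c
  ProperAnc-Anc-trans (a⊑b , a≢b) b⊑c =
    Anc-trans a⊑b b⊑c , λ { refl → a≢b (Anc-antisym a⊑b b⊑c) }

  Child⇒ProperAnc : ∀ {c w} → Child c w → ProperAnc w c
  Child⇒ProperAnc (k , refl , refl) = anc-step k anc-refl , <⇒≢ (par< k)

  Child⇒≢r : ∀ {c w} → Child c w → c ≢ r
  Child⇒≢r (k , refl , _) ()

  child-towards : ∀ {a b} → Anc a b → a ≢ b → Σ V λ c → Child c a × Anc c b
  child-towards anc-refl a≢a = ⊥-elim (a≢a refl)
  child-towards {a} (anc-step k a⊑p) _ with par k ≟ a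
  ... | yes p≡a = suc k , (k , refl , p≡a) , anc-refl
  ... | no p≢a with child-towards a⊑p (p≢a ∘ sym)
  ...   | c , c-child , c⊑p = c , c-child , anc-step k c⊑p

  child-below-sibling⇒≡ : ∀ {c c' w} → Child c w → Child c' w → Anc c c' → c ≡ c'
  child-below-sibling⇒≡ c-child (k , refl , refl) c⊑c' with Anc-suc-inv c⊑c'
  ... | inj₁ c≡c' = c≡c'
  ... | inj₂ c⊑w = ⊥-elim (ProperAnc⇒¬Anc (Child⇒ProperAnc c-child) c⊑w)

  siblings-meet⇒≡ : ∀ {c c' w z} → Child c w → Child c' w → Anc c z → Anc c' z → c ≡ c'
  siblings-meet⇒≡ c-child c'-child c⊑z c'⊑z with ancestors-comparable c⊑z c'⊑z
  ... | inj₁ c⊑c' = child-below-sibling⇒≡ c-child c'-child c⊑c'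
  ... | inj₂ c'⊑c = sym (child-below-sibling⇒≡ c'-child c-child c'⊑c)

module CommonAncestors (G : DFSGraph) where
  open Notions G
  open Ancestry G

  CommonAnc : (V → Set) → V → Set
  CommonAnc S a = ∀ z → S z → Anc a z

  CommonAnc? : ∀ {S} → Decidable S → Decidable (CommonAnc S)
  CommonAnc? S? a = all? λ z → S? z →-dec Anc? a z

  IsNCA? : ∀ {S} → Decidable S → Decidable (IsNCA S)
  IsNCA? S? w = any? S? ×-dec CommonAnc? S? w ×-dec all? λ a → CommonAnc? S? a →-dec Anc? a w

  nca-below : ∀ {S w z} → IsNCA S w → S z → Anc w z
  nca-below (_ , w-common , _) = w-common _

  nca-greatest : ∀ {S w} → IsNCA S w → ∀ a → CommonAnc S a → Anc a w
  nca-greatest (_ , _ , greatest) = greatest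

  nca-exists : ∀ {S} → Decidable S → Σ V S → Σ V (IsNCA S)
  nca-exists {S} S? (z , Sz) with maximiser (CommonAnc? S?) id (r , λ z _ → r-Anc z)
  ... | w , w-common , max =
    w , (z , Sz) , w-common , λ a a-common → ancestors-≤⇒Anc (a-common z Sz) (w-common z Sz) (max a a-common)

  nca-unique : ∀ {S w w'} → IsNCA S w → IsNCA S w' → w ≡ w'
  nca-unique w-nca w'-nca =
    Anc-antisym (nca-greatest w'-nca _ (proj₁ (proj₂ w-nca))) (nca-greatest w-nca _ (proj₁ (proj₂ w'-nca)))

  nca-cong : ∀ {S S' w} → S ⊆ S' → S' ⊆ S → IsNCA S w → IsNCA S' w
  nca-cong S⊆S' S'⊆S ((z , Sz) , w-common , greatest) =
    (z , S⊆S' Sz) , (λ z → w-common z ∘ S'⊆S) , λ a a-common → greatest a (λ z → a-common z ∘ S⊆S')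

  nca-singleton : ∀ {S z} → S z → (∀ z' → S z' → z' ≡ z) → IsNCA S z
  nca-singleton Sz only-z = (_ , Sz) , (λ z' Sz' → subst (Anc _) (sym (only-z z' Sz')) anc-refl) , λ a a-common → a-common _ Sz

  B? : ∀ w i → Dec (B w i)
  B? w i = Anc? w (bx i) ×-dec Anc? (by i) w ×-dec ¬? (by i ≟ w)

  B-or-Anc-by : ∀ {w} i → Anc w (bx i) → B w i ⊎ Anc w (by i)
  B-or-Anc-by {w} i w⊑x with ancestors-comparable w⊑x (back i)
  ... | inj₁ w⊑y = inj₂ w⊑y
  ... | inj₂ y⊑w with by i ≟ w
  ...   | yes refl = inj₂ anc-refl
  ...   | no y≢w = inj₁ (w⊑x , y⊑w , y≢w)

  B-descend : ∀ {w w' i} → B w i → Anc w' (bx i) → Anc w w' → B w' i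
  B-descend (_ , y⊏w) w'⊑x w⊑w' = w'⊑x , ProperAnc-Anc-trans y⊏w w⊑w'

  DescendantEnds : V → V → Set
  DescendantEnds w z = Σ (Fin m) λ i → B w i × bx i ≡ z

  DescendantEnds? : ∀ w → Decidable (DescendantEnds w)
  DescendantEnds? w z = any? λ i → B? w i ×-dec (bx i ≟ z)

  M-exists : ∀ w → ∃ (B w) → Σ V (IsM w)
  M-exists w (i , b) = nca-exists (DescendantEnds? w) (bx i , i , b , refl)

  Anc-M : ∀ {w M} → IsM w M → Anc w M
  Anc-M M-nca = nca-greatest M-nca _ λ { z (i , b , refl) → proj₁ b }

  M-antitone : ∀ {v u Mv Mu} → (∀ {i} → B v i → B u i) → IsM u Mu → IsM v Mv → Anc Mu Mv
  M-antitone Bv⊆Bu Mu-nca Mv-nca =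
    nca-greatest Mv-nca _ λ { z (i , b , refl) → nca-below Mu-nca (i , Bv⊆Bu b , refl) }

  SameM-sym : ∀ {u w} → SameM u w → SameM w u
  SameM-sym (M , Mu , Mw) = M , Mw , Mu

  nextM-exists : ∀ {u w} → w < u → SameM u w → Σ V (IsNextM u)
  nextM-exists {u} {w} w<u (M , Mu , Mw) = next (maximiser P? id (w , w<u , Mw))
    where
      P : V → Set
      P w = w < u × IsM w M

      P? : Decidable P
      P? w = (w <? u) ×-dec IsNCA? (DescendantEnds? w) M

      next : (∃ λ v' → P v' × ∀ w → P w → w ≤ v') → Σ V (IsNextM u)
      next (v' , (v'<u , Mv') , max) =
        v' , v'<u , (M , Mu , Mv') ,
        λ { w w<u (M' , M'u , M'w) → max w (w<u , subst (IsM w) (nca-unique M'u Mu) M'w) }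

  nextM-Anc : ∀ {u u'} → IsNextM u u' → Anc u' u
  nextM-Anc (u'<u , (M , Mu , Mu') , _) = ancestors-≤⇒Anc (Anc-M Mu') (Anc-M Mu) (ℕₚ.<⇒≤ u'<u)

module Cuts (G : DFSGraph) (tec : Notions.ThreeEdgeConnected G) where
  open Notions G
  open Ancestry G
  open CommonAncestors G

  record Closed (del : Edge → Set) (S : V → Set) : Set where
    field
      tree-up   : ∀ k → ¬ del (inj₁ k) → S (suc k) → S (par k)
      tree-down : ∀ k → ¬ del (inj₁ k) → S (par k) → S (suc k)
      back-up   : ∀ i → S (bx i) → S (by i)
      back-down : ∀ i → S (by i) → S (bx i)

  Reach-closed : ∀ {del S a b} → Closed del S → Reach del a b → S a → S b
  Reach-closed cl reach-refl Sa = Sa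
  Reach-closed cl (reach-step a⇝ (inj₁ k) kept (inj₁ refl)) Sa = Closed.tree-up cl k kept (Reach-closed cl a⇝ Sa)
  Reach-closed cl (reach-step a⇝ (inj₁ k) kept (inj₂ refl)) Sa = Closed.tree-down cl k kept (Reach-closed cl a⇝ Sa)
  Reach-closed cl (reach-step a⇝ (inj₂ i) _ (inj₁ refl)) Sa = Closed.back-up cl i (Reach-closed cl a⇝ Sa)
  Reach-closed cl (reach-step a⇝ (inj₂ i) _ (inj₂ refl)) Sa = Closed.back-down cl i (Reach-closed cl a⇝ Sa)

  private
    Without : Edge → Edge → Edge → Set
    Without e₁ e₂ e = e ≡ e₁ ⊎ e ≡ e₂

    kept₁ : ∀ {k k₁ e₂} → ¬ Without (inj₁ k₁) e₂ (inj₁ k) → suc k₁ ≢ suc k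
    kept₁ kept eq = kept (inj₁ (cong inj₁ (suc-injective (sym eq))))

    kept₂ : ∀ {k e₁ k₂} → ¬ Without e₁ (inj₁ k₂) (inj₁ k) → suc k₂ ≢ suc k
    kept₂ kept eq = kept (inj₂ (cong inj₁ (suc-injective (sym eq))))

  -- Otherwise the tree edge above w would be a bridge.
  B-nonempty : ∀ w → w ≢ r → ∃ (B w)
  B-nonempty zero w≢r = ⊥-elim (w≢r refl)
  B-nonempty (suc k) _ with any? (B? (suc k))
  ... | yes B≢∅ = B≢∅
  ... | no B≡∅ =
    ⊥-elim (0≢1+n (sym (Anc-of-r (Reach-closed T[w]-closed (tec (inj₁ k) (inj₁ k) (suc k) r) anc-refl))))
    where
      T[w]-closed : Closed (Without (inj₁ k) (inj₁ k)) (Anc (suc k))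
      T[w]-closed = record
        { tree-up   = λ j kept → [ ⊥-elim ∘ kept₁ kept , id ]′ ∘ Anc-suc-inv
        ; tree-down = λ j _ → anc-step j
        ; back-up   = λ i → [ ⊥-elim ∘ B≡∅ ∘ (i ,_) , id ]′ ∘ B-or-Anc-by i
        ; back-down = λ i w⊑y → Anc-trans w⊑y (back i)
        }

  -- Otherwise the tree edges above w and u would form a 2-cut around T(w) ∖ T(u).
  B-distinct : ∀ {w u} → w ≢ r → ProperAnc w u →
               (∀ {i} → B w i → B u i) → (∀ {i} → B u i → B w i) → ⊥
  B-distinct {zero} w≢r _ _ _ = w≢r refl
  B-distinct {suc kw} {zero} _ (() , _) _ _
  B-distinct {suc kw} {suc ku} _ w⊏u Bw⊆Bu Bu⊆Bw =
    0≢1+n (sym (Anc-of-r (proj₁ (Reach-closed between-closed (tec (inj₁ kw) (inj₁ ku) w r) w-between))))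
    where
      w u : V
      w = suc kw
      u = suc ku

      w-between : Anc w w × ¬ Anc u w
      w-between = anc-refl , ProperAnc⇒¬Anc w⊏u

      Between : V → Set
      Between z = Anc w z × ¬ Anc u z

      between-closed : Closed (Without (inj₁ kw) (inj₁ ku)) Between
      between-closed = record
        { tree-up   = λ j kept (w⊑ , u⋢) →
            [ ⊥-elim ∘ kept₁ kept , id ]′ (Anc-suc-inv w⊑) , u⋢ ∘ anc-step j
        ; tree-down = λ j kept (w⊑ , u⋢) →
            anc-step j w⊑ , [ kept₂ kept , u⋢ ]′ ∘ Anc-suc-inv
        ; back-up   = λ i (w⊑x , u⋢x) →
            [ ⊥-elim ∘ u⋢x ∘ proj₁ ∘ Bw⊆Bu , id ]′ (B-or-Anc-by i w⊑x) , u⋢x ∘ flip Anc-trans (back i)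
        ; back-down = λ i (w⊑y , u⋢y) →
            Anc-trans w⊑y (back i) , [ flip ProperAnc⇒¬Anc w⊑y ∘ proj₂ ∘ Bu⊆Bw , u⋢y ]′ ∘ B-or-Anc-by i
        }

  low1-exists : ∀ w → w ≢ r → Σ V (IsLow1 w)
  low1-exists w w≢r with minimiser (B? w) by (B-nonempty w w≢r)
  ... | i , b , min = by i , (i , b , refl) , min

module FirstChildren (G : DFSGraph) (tec : Notions.ThreeEdgeConnected G) (co : Notions.ChildOrder G) where
  open Notions G
  open ChildOrder co
  open Ancestry G
  open Cuts G tec

  LowLt : V → V → Set
  LowLt a c = ∀ ya yc → IsLow1 a ya → IsLow1 c yc → ya < yc

  LowLt⇒¬LowLe : ∀ {a c} → a ≢ r → c ≢ r → LowLt a c → ¬ LowLe c a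
  LowLt⇒¬LowLe {a} {c} a≢r c≢r a≺c c≼a with low1-exists a a≢r | low1-exists c c≢r
  ... | ya , low1[a] | yc , low1[c] = ℕₚ.<⇒≱ (a≺c ya yc low1[a] low1[c]) (c≼a yc ya low1[c] low1[a])

  c₁-strict-min : ∀ {w c} → Child c w → (∀ c' → Child c' w → c' ≢ c → LowLt c c') → c₁ w ≡ just c
  c₁-strict-min {w} {c} c-child c-min with c₁ w | c₁-nothing w | c₁-just w
  ... | nothing | childless | _ = ⊥-elim (childless refl c c-child)
  ... | just a | _ | first with first a refl
  ...   | a-child , a-min with a ≟ c
  ...     | yes refl = refl
  ...     | no a≢c =
    ⊥-elim (LowLt⇒¬LowLe (Child⇒≢r c-child) (Child⇒≢r a-child) (c-min a a-child a≢c) (a-min c c-child))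

  c₂-strict-second-min : ∀ {w c c'} → c₁ w ≡ just c → Child c' w → c' ≢ c →
    (∀ c'' → Child c'' w → c'' ≢ c → c'' ≢ c' → LowLt c' c'') → c₂ w ≡ just c'
  c₂-strict-second-min {w} {c} {c'} c₁≡c c'-child c'≢c c'-min with c₂ w | c₂-nothing w | c₂-just w
  ... | nothing | only-child | _ = ⊥-elim (c'≢c (just-injective (trans (sym (only-child refl c' c'-child)) c₁≡c)))
  ... | just b | _ | second with second b refl
  ...   | b-child , c₁≢b , b-min with b ≟ c'
  ...     | yes refl = refl
  ...     | no b≢c' = ⊥-elim (LowLt⇒¬LowLe (Child⇒≢r c'-child) (Child⇒≢r b-child)
                                (c'-min b b-child (c₁≢b ∘ trans c₁≡c ∘ cong just ∘ sym) b≢c')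
                                (b-min c' c'-child (c'≢c ∘ just-injective ∘ flip trans c₁≡c ∘ sym)))

module OneExtraBackEdge
  (G : DFSGraph) (tec : Notions.ThreeEdgeConnected G) (co : Notions.ChildOrder G)
  (u v : Notions.V G) (v⊑u : DFSGraph.Anc G v u) (v≢r : v ≢ Notions.r G) (e : Fin (DFSGraph.m G))
  (Bu⊆Bv+e : ∀ i → Notions.B G u i → Notions.B G v i ⊎ i ≡ e)
  (Bv+e⊆Bu : ∀ i → Notions.B G v i ⊎ i ≡ e → Notions.B G u i)
  (e∉Bv : ¬ Notions.B G v e)
  where

  open Notions G
  open ChildOrder co
  open Ancestry G
  open CommonAncestors G
  open Cuts G tec
  open FirstChildren G tec co

  x y : V
  x = bx e
  y = by e

  e∈Bu : B u e
  e∈Bu = Bv+e⊆Bu e (inj₂ refl)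

  Bv⊆Bu : ∀ {i} → B v i → B u i
  Bv⊆Bu b = Bv+e⊆Bu _ (inj₁ b)

  u⊑x : Anc u x
  u⊑x = proj₁ e∈Bu

  y<u : y < u
  y<u = ProperAnc⇒< (proj₂ e∈Bu)

  v⊑y : Anc v y
  v⊑y = [ ⊥-elim ∘ e∉Bv , id ]′ (B-or-Anc-by e (Anc-trans v⊑u u⊑x))

  by<y : ∀ {i} → B v i → by i < y
  by<y b = ℕₚ.<-≤-trans (ProperAnc⇒< (proj₂ b)) (Anc⇒≤ v⊑y)

  v<u : v < u
  v<u = ℕₚ.≤-<-trans (Anc⇒≤ v⊑y) y<u

  M[u] : V
  M[u] = proj₁ (M-exists u (e , e∈Bu))

  M[u]-is : IsM u M[u]
  M[u]-is = proj₂ (M-exists u (e , e∈Bu))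

  M[v] : V
  M[v] = proj₁ (M-exists v (B-nonempty v v≢r))

  M[v]-is : IsM v M[v]
  M[v]-is = proj₂ (M-exists v (B-nonempty v v≢r))

  u⊑M[u] : Anc u M[u]
  u⊑M[u] = Anc-M M[u]-is

  M[u]⊑x : Anc M[u] x
  M[u]⊑x = nca-below M[u]-is (e , e∈Bu , refl)

  M[u]⊑M[v] : Anc M[u] M[v]
  M[u]⊑M[v] = M-antitone Bv⊆Bu M[u]-is M[v]-is

  M[v]⊑bx : ∀ {i} → B v i → Anc M[v] (bx i)
  M[v]⊑bx b = nca-below M[v]-is (_ , b , refl)

  outside-T[M[v]]⇒≡e : ∀ {i} → B u i → ¬ Anc M[v] (bx i) → i ≡ e
  outside-T[M[v]]⇒≡e {i} b M[v]⋢bx = [ ⊥-elim ∘ M[v]⋢bx ∘ M[v]⊑bx , id ]′ (Bu⊆Bv+e i b)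

  y≤by-outside-T[M[v]] : ∀ i → Anc u (bx i) → ¬ Anc M[v] (bx i) → y ≤ by i
  y≤by-outside-T[M[v]] i u⊑bx M[v]⋢bx with B-or-Anc-by i u⊑bx
  ... | inj₁ b = ≤-reflexive (cong by (sym (outside-T[M[v]]⇒≡e b M[v]⋢bx)))
  ... | inj₂ u⊑by = ℕₚ.<⇒≤ (ℕₚ.<-≤-trans y<u (Anc⇒≤ u⊑by))

  l₁[x]≡y : ¬ Anc M[v] x → IsL1 x y
  l₁[x]≡y M[v]⋢x = inj₂ (e , refl , refl) , λ i bx≡x →
    y≤by-outside-T[M[v]] i (subst (Anc u) (sym bx≡x) u⊑x) (M[v]⋢x ∘ subst (Anc M[v]) bx≡x)

  module SameM-case (M[v]≡M[u] : M[v] ≡ M[u]) where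

    u-sameM-v : SameM u v
    u-sameM-v = M[u] , M[u]-is , subst (IsM v) M[v]≡M[u] M[v]-is

    module _ {v'} (next : IsNextM u v') where

      v'⊑u : Anc v' u
      v'⊑u = nextM-Anc next

      v⊑v' : Anc v v'
      v⊑v' = ancestors-≤⇒Anc v⊑u v'⊑u (proj₂ (proj₂ next) v v<u u-sameM-v)

      M[v']-is : IsM v' M[u]
      M[v']-is with proj₁ (proj₂ next)
      ... | M , Mu , Mv' = subst (IsM v') (nca-unique Mu M[u]-is) Mv'

      Bv⊆Bv' : ∀ {i} → B v i → B v' i
      Bv⊆Bv' b = B-descend b (Anc-trans v'⊑u (proj₁ (Bv⊆Bu b))) v⊑v'

      Bv'⊆Bu : ∀ {i} → B v' i → B u i
      Bv'⊆Bu b = B-descend b (Anc-trans u⊑M[u] (nca-below M[v']-is (_ , b , refl))) v'⊑u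

      e∉Bv' : ¬ B v' e
      e∉Bv' e∈Bv' = B-distinct (Anc-≢r v⊑v' v≢r) (v'⊑u , <⇒≢ (proj₁ next)) Bv'⊆Bu Bu⊆Bv'
        where
          Bu⊆Bv' : ∀ {i} → B u i → B v' i
          Bu⊆Bv' {i} b = [ Bv⊆Bv' , (λ { refl → e∈Bv' }) ]′ (Bu⊆Bv+e i b)

      Bu∖Bv'≡e : ∀ i → B u i → ¬ B v' i → i ≡ e
      Bu∖Bv'≡e i b i∉Bv' = [ ⊥-elim ∘ i∉Bv' ∘ Bv⊆Bv' , id ]′ (Bu⊆Bv+e i b)

    low_M[u]≡y : IsLowM u y
    low_M[u]≡y with nextM-exists v<u u-sameM-v
    ... | v' , next = v' , next , (e , e∈Bu , e∉Bv' next , refl) ,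
                      λ i b i∉Bv' → ≤-reflexive (cong by (sym (Bu∖Bv'≡e next i b i∉Bv')))

    low_MD[u]≡x : ∀ x' → IsLowMD u x' → x ≡ x'
    low_MD[u]≡x x' (v' , next , _ , _ , i , b , i∉Bv' , bx≡x' , _) =
      trans (cong bx (sym (Bu∖Bv'≡e next i b i∉Bv'))) bx≡x'

  module DistinctM-case (M[v]≢M[u] : M[v] ≢ M[u]) where

    M[u]⊏M[v] : ProperAnc M[u] M[v]
    M[u]⊏M[v] = M[u]⊑M[v] , M[v]≢M[u] ∘ sym

    M[v]⋢x : ¬ Anc M[v] x
    M[v]⋢x M[v]⊑x = ProperAnc⇒¬Anc M[u]⊏M[v] (nca-greatest M[u]-is M[v] M[v]-common)
      where
        M[v]-common : CommonAnc (DescendantEnds u) M[v]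
        M[v]-common z (i , b , refl) = [ M[v]⊑bx , (λ { refl → M[v]⊑x }) ]′ (Bu⊆Bv+e i b)

    M̃[u]≡M[v] : x ≡ M[u] → IsMtilde u M[v]
    M̃[u]≡M[v] x≡M[u] = M[u] , M[u]-is , nca-cong to from M[v]-is
      where
        to : DescendantEnds v ⊆ λ z → Σ (Fin m) λ i → B u i × bx i ≡ z × ProperAnc M[u] z
        to (i , b , refl) = i , Bv⊆Bu b , refl , ProperAnc-Anc-trans M[u]⊏M[v] (M[v]⊑bx b)

        from : (λ z → Σ (Fin m) λ i → B u i × bx i ≡ z × ProperAnc M[u] z) ⊆ DescendantEnds v
        from (i , b , refl , M[u]⊏bx) =
          [ (λ b' → i , b' , refl) , (λ { refl → ⊥-elim (proj₂ M[u]⊏bx (sym x≡M[u])) }) ]′ (Bu⊆Bv+e i b)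

    module TwoChildren {c c'} (c-child : Child c M[u]) (c⊑M[v] : Anc c M[v])
                              (c'-child : Child c' M[u]) (c'⊑x : Anc c' x) where

      c≢c' : c ≢ c'
      c≢c' c≡c' = ProperAnc⇒¬Anc (Child⇒ProperAnc c-child) (nca-greatest M[u]-is c c-common)
        where
          c-common : CommonAnc (DescendantEnds u) c
          c-common z (i , b , refl) =
            [ Anc-trans c⊑M[v] ∘ M[v]⊑bx , (λ { refl → subst (λ a → Anc a x) (sym c≡c') c'⊑x }) ]′
              (Bu⊆Bv+e i b)

      T[c]-T[c']-disjoint : ∀ {z} → Anc c z → Anc c' z → ⊥
      T[c]-T[c']-disjoint c⊑z c'⊑z = c≢c' (siblings-meet⇒≡ c-child c'-child c⊑z c'⊑z)

      u⊑child : ∀ {c''} → Child c'' M[u] → Anc u c''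
      u⊑child c''-child = Anc-trans u⊑M[u] (proj₁ (Child⇒ProperAnc c''-child))

      B-of-other-child : ∀ {c'' i} → Child c'' M[u] → c'' ≢ c → B c'' i → u ≤ by i ⊎ i ≡ e
      B-of-other-child {c''} {i} c''-child c''≢c b with B-or-Anc-by i (Anc-trans (u⊑child c''-child) (proj₁ b))
      ... | inj₁ b' = inj₂ (outside-T[M[v]]⇒≡e b' λ M[v]⊑bx →
                        c''≢c (siblings-meet⇒≡ c''-child c-child (proj₁ b) (Anc-trans c⊑M[v] M[v]⊑bx)))
      ... | inj₂ u⊑by = inj₁ (Anc⇒≤ u⊑by)

      low1[c]<y : ∀ {yc} → IsLow1 c yc → yc < y
      low1[c]<y (_ , min) = ℕₚ.≤-<-trans (min _ (Bv⊆Bc (proj₂ B[v]≢∅))) (by<y (proj₂ B[v]≢∅))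
        where
          B[v]≢∅ : ∃ (B v)
          B[v]≢∅ = B-nonempty v v≢r

          Bv⊆Bc : ∀ {i} → B v i → B c i
          Bv⊆Bc b = B-descend b (Anc-trans c⊑M[v] (M[v]⊑bx b)) (Anc-trans v⊑u (u⊑child c-child))

      low1[c']≤y : ∀ {yc'} → IsLow1 c' yc' → yc' ≤ y
      low1[c']≤y (_ , min) = min e (B-descend e∈Bu c'⊑x (u⊑child c'-child))

      y≤low1 : ∀ {c'' y''} → Child c'' M[u] → c'' ≢ c → IsLow1 c'' y'' → y ≤ y''
      y≤low1 c''-child c''≢c ((i , b , refl) , _) =
        [ ℕₚ.<⇒≤ ∘ ℕₚ.<-≤-trans y<u , (λ { refl → ≤-refl }) ]′ (B-of-other-child c''-child c''≢c b)

      y<low1 : ∀ {c'' y''} → Child c'' M[u] → c'' ≢ c → c'' ≢ c' → IsLow1 c'' y'' → y < y''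
      y<low1 c''-child c''≢c c''≢c' ((i , b , refl) , _) =
        [ ℕₚ.<-≤-trans y<u , (λ { refl → ⊥-elim (c''≢c' (siblings-meet⇒≡ c''-child c'-child (proj₁ b) c'⊑x)) }) ]′
          (B-of-other-child c''-child c''≢c b)

      c₁≡c : c₁ M[u] ≡ just c
      c₁≡c = c₁-strict-min c-child λ c'' c''-child c''≢c _ _ low1[c] low1[c''] →
        ℕₚ.<-≤-trans (low1[c]<y low1[c]) (y≤low1 c''-child c''≢c low1[c''])

      c₂≡c' : c₂ M[u] ≡ just c'
      c₂≡c' = c₂-strict-second-min c₁≡c c'-child (c≢c' ∘ sym) λ c'' c''-child c''≢c c''≢c' _ _ low1[c'] low1[c''] →
        ℕₚ.≤-<-trans (low1[c']≤y low1[c']) (y<low1 c''-child c''≢c c''≢c' low1[c''])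

      M_low1[u]≡M[v] : IsMlow1 co u M[v]
      M_low1[u]≡M[v] = M[u] , M[u]-is , c , c₁≡c , nca-cong to from M[v]-is
        where
          to : DescendantEnds v ⊆ λ z → Σ (Fin m) λ i → B u i × bx i ≡ z × Anc c z
          to (i , b , refl) = i , Bv⊆Bu b , refl , Anc-trans c⊑M[v] (M[v]⊑bx b)

          from : (λ z → Σ (Fin m) λ i → B u i × bx i ≡ z × Anc c z) ⊆ DescendantEnds v
          from (i , b , refl , c⊑bx) =
            [ (λ b' → i , b' , refl) , (λ { refl → ⊥-elim (T[c]-T[c']-disjoint c⊑bx c'⊑x) }) ]′ (Bu⊆Bv+e i b)

      M_low2[u]≡x : IsMlow2 co u x
      M_low2[u]≡x = M[u] , M[u]-is , c' , c₂≡c' , nca-singleton (e , e∈Bu , refl , c'⊑x) only-x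
        where
          only-x : ∀ z → (Σ (Fin m) λ i → B u i × bx i ≡ z × Anc c' z) → z ≡ x
          only-x z (i , b , refl , c'⊑bx) =
            cong bx (outside-T[M[v]]⇒≡e b λ M[v]⊑bx → T[c]-T[c']-disjoint (Anc-trans c⊑M[v] M[v]⊑bx) c'⊑bx)

  classification :
    (SameM v u
       × Σ V (λ y → IsLowM u y × by e ≡ y × (∀ x → IsLowMD u x → bx e ≡ x)))
    ⊎ (Σ V (λ w → IsM v w × IsMtilde u w)
       × Σ V (λ mu → IsM u mu × bx e ≡ mu × IsL1 mu (by e)))
    ⊎ (Σ V (λ w → IsM v w × IsMlow1 co u w)
       × Σ V (λ z → IsMlow2 co u z × bx e ≡ z × IsL1 z (by e)))
  classification with M[v] ≟ M[u] | x ≟ M[u]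
  ... | yes M[v]≡M[u] | _ = inj₁ (SameM-sym u-sameM-v , y , low_M[u]≡y , refl , low_MD[u]≡x)
    where open SameM-case M[v]≡M[u]
  ... | no M[v]≢M[u] | yes x≡M[u] =
    inj₂ (inj₁ ((M[v] , M[v]-is , M̃[u]≡M[v] x≡M[u]) ,
                (M[u] , M[u]-is , x≡M[u] , subst (λ z → IsL1 z y) x≡M[u] (l₁[x]≡y M[v]⋢x))))
    where open DistinctM-case M[v]≢M[u]
  ... | no M[v]≢M[u] | no x≢M[u]
    with child-towards M[u]⊑M[v] (M[v]≢M[u] ∘ sym) | child-towards M[u]⊑x (x≢M[u] ∘ sym)
  ...   | c , c-child , c⊑M[v] | c' , c'-child , c'⊑x =
    inj₂ (inj₂ ((M[v] , M[v]-is , M_low1[u]≡M[v]) , (x , M_low2[u]≡x , refl , l₁[x]≡y M[v]⋢x)))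
    where
      open DistinctM-case M[v]≢M[u]
      open TwoChildren c-child c⊑M[v] c'-child c'⊑x

lemma3 : (G : DFSGraph) → let open Notions G in
    (co : ChildOrder) →
    ThreeEdgeConnected →
    (u v : V) → Anc v u → v ≢ r →
    (e : Fin m) →
    (∀ i → B u i → B v i ⊎ i ≡ e) →
    (∀ i → B v i ⊎ i ≡ e → B u i) →
    ¬ B v e →
    (SameM v u
       × Σ V (λ y → IsLowM u y × by e ≡ y × (∀ x → IsLowMD u x → bx e ≡ x)))
    ⊎ (Σ V (λ w → IsM v w × IsMtilde u w)
       × Σ V (λ mu → IsM u mu × bx e ≡ mu × IsL1 mu (by e)))
    ⊎ (Σ V (λ w → IsM v w × IsMlow1 co u w)
       × Σ V (λ z → IsMlow2 co u z × bx e ≡ z × IsL1 z (by e)))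
lemma3 G co tec u v v⊑u v≢r e Bu⊆Bv+e Bv+e⊆Bu e∉Bv = classification
  where open OneExtraBackEdge G tec co u v v⊑u v≢r e Bu⊆Bv+e Bv+e⊆Bu e∉Bv
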